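{- Let $p$ be a prime, $n$ a positive integer, and $\Omega = \{0,1\}^n$. Let $f:\Omega\to\mathbb{F}_p$ and let $i \in \mathbb{F}_p$. For $A \subseteq [n]$, let $V_A \in \{0,1\}^n$ be its $0$-$1$ incidence vector and let $x_A:\Omega\to\mathbb{F}_p$ be the function $x\mapsto \prod_{j\in A} x_j$. Assume $f(V_A) \neq 0$ for every $A\subseteq[n]$ with $|A| \not\equiv i \pmod p$. Then the set of functions $\{x_Af~:~A\subseteq[n],\ |A| \not\equiv i \pmod p \text{ and } |A| < p\}$ is linearly independent in the vector space $\mathbb{F}_p^{\Omega}$ over $\mathbb{F}_p$.
   Context: $[n]=\{1,\ldots,n\}$; $\mathbb{F}_p^{\Omega}$ denotes the $\mathbb{F}_p$-vector space of all functions $\Omega\to\mathbb{F}_p$, and $x_Af$ is the pointwise product. -}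

module Defs where

open import Data.Nat using (ℕ; zero; suc; NonZero)
import Data.Nat as ℕ
open import Data.Nat.DivMod using (_mod_)
open import Data.Fin using (Fin; toℕ)
open import Data.Fin.Subset using (Subset; Side; inside; outside; ∣_∣)
open import Data.Vec using (Vec; []; _∷_; lookup)
open import Data.List using (List; []; _∷_; map; _++_; foldr; allFin)
open import Data.Bool using (Bool; true; false; if_then_else_)
open import Relation.Nullary using (¬_)
open import Relation.Binary.PropositionalEquality using (_≡_)

-- The prime field F_p, represented as Fin p with arithmetic modulo p.
𝔽 : (p : ℕ) → Set
𝔽 p = Fin p

module _ (p : ℕ) .{{_ : NonZero p}} where

  ι : ℕ → 𝔽 p
  ι k = k mod p

  0F : 𝔽 p
  0F = ι 0

  1F : 𝔽 p
  1F = ι 1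

  _+F_ : 𝔽 p → 𝔽 p → 𝔽 p
  a +F b = ι (toℕ a ℕ.+ toℕ b)

  _*F_ : 𝔽 p → 𝔽 p → 𝔽 p
  a *F b = ι (toℕ a ℕ.* toℕ b)

  sumF : List (𝔽 p) → 𝔽 p
  sumF = foldr _+F_ 0F

  prodF : List (𝔽 p) → 𝔽 p
  prodF = foldr _*F_ 1F

-- Ω = {0,1}^n, points as Boolean vectors (true = 1, false = 0)
Ω : ℕ → Set
Ω n = Vec Bool n

allSubsets : (n : ℕ) → List (Subset n)
allSubsets zero = [] ∷ []
allSubsets (suc n) = map (inside ∷_) (allSubsets n) ++ map (outside ∷_) (allSubsets n)

V : {n : ℕ} → Subset n → Ω n
V A = A

bitF : (p : ℕ) .{{_ : NonZero p}} → Bool → 𝔽 p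
bitF p b = if b then 1F p else 0F p

monomial : (p : ℕ) .{{_ : NonZero p}} {n : ℕ} → Subset n → Ω n → 𝔽 p
monomial p {n} A x =
  prodF p (map (λ j → if lookup A j then bitF p (lookup x j) else 1F p) (allFin n))

_·_ : {p : ℕ} .{{_ : NonZero p}} {n : ℕ} → (Ω n → 𝔽 p) → (Ω n → 𝔽 p) → Ω n → 𝔽 p
_·_ {p} g h x = _*F_ p (g x) (h x)

-- Coefficient families are encoded
-- as c : Subset n → F_p that vanish outside S; the sum runs over all subsets.
LinearlyIndependent : (p : ℕ) .{{_ : NonZero p}} (n : ℕ)
  (S : Subset n → Set) (g : Subset n → Ω n → 𝔽 p) → Set
LinearlyIndependent p n S g =
  (c : Subset n → 𝔽 p) →
  (∀ A → ¬ S A → c A ≡ 0F p) →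
  (∀ x → sumF p (map (λ A → _*F_ p (c A) (g A x)) (allSubsets n)) ≡ 0F p) →
  ∀ A → S A → c A ≡ 0F p

-- The argument is a triangularity argument.  Order the subsets of [n] by
-- cardinality and evaluate the family at the incidence vectors V_A.  The
-- monomial x_B satisfies x_B(V_A) = 1 if B = A and x_B(V_A) = 0 if B ⊈ A,
-- so the "matrix" (g_B(V_A))_{A,B} with g_B = x_B · f is triangular with
-- diagonal entries f(V_A).  Hence, given a vanishing combination Σ_B c_B g_B,
-- evaluation at V_A and strong induction on |A| leave only c_A · f(V_A) = 0;
-- as 𝔽_p has no zero divisors, c_A = 0 or f(V_A) = 0, and the latter forces
-- A to lie outside the index set, where c_A = 0 by assumption.
--
-- The theorem is then a short corollary.
module Submission where

open import Defs
open import Data.Nat using (ℕ; NonZero; _<_; _≥_)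
open import Data.Nat.DivMod using (_mod_)
open import Data.Nat.Primality using (Prime)
open import Data.Fin using (Fin)
open import Data.Fin.Subset using (Subset; ∣_∣)
open import Data.Product using (_×_)
open import Relation.Nullary using (¬_)
open import Relation.Binary.PropositionalEquality using (_≡_; _≢_)

import Data.Nat as ℕ
import Data.Nat.Properties as ℕ
open import Data.Nat.DivMod using (_%_; m<n⇒m%n≡m; m%n<n)
open import Data.Nat.Divisibility using (_∣_; m%n≡0⇒n∣m; n∣m⇒m%n≡0)
open import Data.Nat.Primality using (euclidsLemma; prime⇒nonTrivial)
open import Data.Nat.Induction using (<-wellFounded)
open import Data.Fin using (toℕ)
open import Data.Fin.Properties using (toℕ-injective; toℕ-fromℕ<; toℕ<n; ¬∀⟶∃¬)
open import Data.Fin.Subset using (_∈_; _∉_; _⊆_; _⊈_; inside; outside)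
open import Data.Fin.Subset.Properties using (_∈?_; _⊆?_; ⊆-antisym; p⊂q⇒∣p∣<∣q∣)
open import Data.Vec using ([]; _∷_; lookup; tail)
open import Data.Vec.Properties using ([]=⇒lookup; lookup⇒[]=)
open import Data.List using (List; []; _∷_; map; _++_; foldr; allFin)
open import Data.List.Properties using (map-++; foldr-++; map-∘)
open import Data.List.Relation.Unary.Any using (here; there)
import Data.List.Membership.Propositional as List
open import Data.List.Membership.Propositional.Properties using (∈-allFin; ∈-map⁺)
open import Data.Bool using (true; false; if_then_else_)
open import Data.Sum using (_⊎_; inj₁; inj₂)
open import Data.Product using (_,_; ∃)
open import Data.Empty using (⊥-elim)
open import Function using (_∘_)
open import Induction.WellFounded using (module All)
open import Relation.Binary.Construct.On as On using ()
open import Relation.Nullary using (yes; no; contradiction)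
open import Relation.Nullary.Decidable using (_→-dec_)
open import Relation.Binary.PropositionalEquality
  using (refl; sym; trans; cong; cong₂; subst; module ≡-Reasoning)

∉⇒lookup-outside : ∀ {n} {A : Subset n} {j : Fin n} → j ∉ A → lookup A j ≡ outside
∉⇒lookup-outside {A = A} {j} j∉A with lookup A j in eq
... | true  = contradiction (lookup⇒[]= j A eq) j∉A
... | false = refl

⊈⇒witness : ∀ {n} {B A : Subset n} → B ⊈ A → ∃ λ j → j ∈ B × j ∉ A
⊈⇒witness {n} {B} {A} B⊈A
  with ¬∀⟶∃¬ n (λ j → j ∈ B → j ∈ A) (λ j → (j ∈? B) →-dec (j ∈? A))
             (λ incl → B⊈A (λ {j} → incl j))
... | j , ¬incl with j ∈? B
...   | yes j∈B = j , j∈B , λ j∈A → ¬incl (λ _ → j∈A)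
...   | no  j∉B = ⊥-elim (¬incl (λ j∈B → contradiction j∈B j∉B))

⊆∧≢⇒∣∣< : ∀ {n} {B A : Subset n} → B ⊆ A → B ≢ A → ∣ B ∣ < ∣ A ∣
⊆∧≢⇒∣∣< B⊆A B≢A =
  p⊂q⇒∣p∣<∣q∣ (B⊆A , ⊈⇒witness (λ A⊆B → B≢A (⊆-antisym B⊆A A⊆B)))

module _ (p : ℕ) .{{_ : NonZero p}} where

  infixl 7 _*ₚ_
  infixl 6 _+ₚ_

  _+ₚ_ _*ₚ_ : 𝔽 p → 𝔽 p → 𝔽 p
  _+ₚ_ = _+F_ p
  _*ₚ_ = _*F_ p

  0ₚ 1ₚ : 𝔽 p
  0ₚ = 0F p
  1ₚ = 1F p

  toℕ-ι : ∀ k → toℕ (ι p k) ≡ k % p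
  toℕ-ι k = toℕ-fromℕ< (m%n<n k p)

  toℕ-0ₚ : toℕ 0ₚ ≡ 0
  toℕ-0ₚ = trans (toℕ-ι 0) (m<n⇒m%n≡m (ℕ.>-nonZero⁻¹ p))

  ι-toℕ : (x : 𝔽 p) → ι p (toℕ x) ≡ x
  ι-toℕ x = toℕ-injective (trans (toℕ-ι (toℕ x)) (m<n⇒m%n≡m (toℕ<n x)))

  +-identityˡ : (r : 𝔽 p) → 0ₚ +ₚ r ≡ r
  +-identityˡ r rewrite toℕ-0ₚ = ι-toℕ r

  +-identityʳ : (r : 𝔽 p) → r +ₚ 0ₚ ≡ r
  +-identityʳ r rewrite toℕ-0ₚ | ℕ.+-identityʳ (toℕ r) = ι-toℕ r

  *-zeroˡ : (r : 𝔽 p) → 0ₚ *ₚ r ≡ 0ₚ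
  *-zeroˡ r rewrite toℕ-0ₚ = refl

  *-zeroʳ : (r : 𝔽 p) → r *ₚ 0ₚ ≡ 0ₚ
  *-zeroʳ r rewrite toℕ-0ₚ | ℕ.*-zeroʳ (toℕ r) = refl

  -- 1 is a unit as soon as 1 ≠ 0 in 𝔽_p, i.e. p > 1.
  *-identityˡ : 1 < p → (r : 𝔽 p) → 1ₚ *ₚ r ≡ r
  *-identityˡ 1<p r
    rewrite trans (toℕ-ι 1) (m<n⇒m%n≡m 1<p) | ℕ.+-identityʳ (toℕ r) = ι-toℕ r

  divisible⇒0ₚ : (x : 𝔽 p) → p ∣ toℕ x → x ≡ 0ₚ
  divisible⇒0ₚ x p∣x = toℕ-injective (begin
    toℕ x      ≡⟨ sym (m<n⇒m%n≡m (toℕ<n x)) ⟩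
    toℕ x % p  ≡⟨ n∣m⇒m%n≡0 (toℕ x) p p∣x ⟩
    0          ≡⟨ sym toℕ-0ₚ ⟩
    toℕ 0ₚ     ∎)
    where open ≡-Reasoning

  zero-product : Prime p → (a b : 𝔽 p) → a *ₚ b ≡ 0ₚ → a ≡ 0ₚ ⊎ b ≡ 0ₚ
  zero-product p-prime a b ab≡0
    with euclidsLemma (toℕ a) (toℕ b) p-prime (m%n≡0⇒n∣m _ p
           (trans (sym (toℕ-ι (toℕ a ℕ.* toℕ b))) (trans (cong toℕ ab≡0) toℕ-0ₚ)))
  ... | inj₁ p∣a = inj₁ (divisible⇒0ₚ a p∣a)
  ... | inj₂ p∣b = inj₂ (divisible⇒0ₚ b p∣b)

  sum-zeros : ∀ {X : Set} (L : List X) (h : X → 𝔽 p) (z : 𝔽 p) →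
    (∀ x → h x ≡ 0ₚ) → foldr _+ₚ_ z (map h L) ≡ z
  sum-zeros []      h z h≡0 = refl
  sum-zeros (x ∷ L) h z h≡0 rewrite sum-zeros L h z h≡0 | h≡0 x = +-identityˡ z

  sum-split : ∀ n (g : Subset (ℕ.suc n) → 𝔽 p) →
    sumF p (map g (allSubsets (ℕ.suc n)))
      ≡ foldr _+ₚ_ (sumF p (map (g ∘ (outside ∷_)) (allSubsets n)))
                   (map (g ∘ (inside ∷_)) (allSubsets n))
  sum-split n g = begin
    foldr _+ₚ_ 0ₚ (map g (map (inside ∷_) S ++ map (outside ∷_) S))
      ≡⟨ cong (foldr _+ₚ_ 0ₚ) (map-++ g (map (inside ∷_) S) (map (outside ∷_) S)) ⟩
    foldr _+ₚ_ 0ₚ (map g (map (inside ∷_) S) ++ map g (map (outside ∷_) S))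
      ≡⟨ foldr-++ _+ₚ_ 0ₚ (map g (map (inside ∷_) S)) (map g (map (outside ∷_) S)) ⟩
    foldr _+ₚ_ (foldr _+ₚ_ 0ₚ (map g (map (outside ∷_) S))) (map g (map (inside ∷_) S))
      ≡⟨ cong₂ (foldr _+ₚ_) (cong (foldr _+ₚ_ 0ₚ) (sym (map-∘ S))) (sym (map-∘ S)) ⟩
    foldr _+ₚ_ (sumF p (map (g ∘ (outside ∷_)) S)) (map (g ∘ (inside ∷_)) S) ∎
    where
    open ≡-Reasoning
    S = allSubsets n

  sum-single : ∀ n (A : Subset n) (g : Subset n → 𝔽 p) →
    (∀ B → B ≢ A → g B ≡ 0ₚ) → sumF p (map g (allSubsets n)) ≡ g A
  sum-single ℕ.zero    []      g _    = +-identityʳ (g [])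
  sum-single (ℕ.suc n) (inside ∷ A) g off = begin
    sumF p (map g (allSubsets (ℕ.suc n)))
      ≡⟨ sum-split n g ⟩
    foldr _+ₚ_ (sumF p (map (g ∘ (outside ∷_)) S)) (map (g ∘ (inside ∷_)) S)
      ≡⟨ cong (λ z → foldr _+ₚ_ z (map (g ∘ (inside ∷_)) S))
              (sum-zeros S (g ∘ (outside ∷_)) 0ₚ (λ B → off (outside ∷ B) λ ())) ⟩
    sumF p (map (g ∘ (inside ∷_)) S)
      ≡⟨ sum-single n A (g ∘ (inside ∷_)) (λ B B≢A → off (inside ∷ B) (B≢A ∘ cong tail)) ⟩
    g (inside ∷ A) ∎
    where
    open ≡-Reasoning
    S = allSubsets n
  sum-single (ℕ.suc n) (outside ∷ A) g off = begin
    sumF p (map g (allSubsets (ℕ.suc n)))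
      ≡⟨ sum-split n g ⟩
    foldr _+ₚ_ (sumF p (map (g ∘ (outside ∷_)) S)) (map (g ∘ (inside ∷_)) S)
      ≡⟨ sum-zeros S (g ∘ (inside ∷_)) _ (λ B → off (inside ∷ B) λ ()) ⟩
    sumF p (map (g ∘ (outside ∷_)) S)
      ≡⟨ sum-single n A (g ∘ (outside ∷_)) (λ B B≢A → off (outside ∷ B) (B≢A ∘ cong tail)) ⟩
    g (outside ∷ A) ∎
    where
    open ≡-Reasoning
    S = allSubsets n

  prod-zero : (L : List (𝔽 p)) → 0ₚ List.∈ L → prodF p L ≡ 0ₚ
  prod-zero (x ∷ L) (here refl) = *-zeroˡ (prodF p L)
  prod-zero (x ∷ L) (there 0∈L) rewrite prod-zero L 0∈L = *-zeroʳ x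

  prod-ones : 1 < p → ∀ {X : Set} (L : List X) (h : X → 𝔽 p) →
    (∀ x → h x ≡ 1ₚ) → prodF p (map h L) ≡ 1ₚ
  prod-ones 1<p []      h h≡1 = refl
  prod-ones 1<p (x ∷ L) h h≡1 rewrite prod-ones 1<p L h h≡1 | h≡1 x = *-identityˡ 1<p 1ₚ

  factor : ∀ {n} → Subset n → Ω n → Fin n → 𝔽 p
  factor B x j = if lookup B j then bitF p (lookup x j) else 1ₚ

  monomial-diagonal : 1 < p → ∀ {n} (A : Subset n) → monomial p A (V A) ≡ 1ₚ
  monomial-diagonal 1<p {n} A = prod-ones 1<p (allFin n) (factor A A) (λ j → at (lookup A j))
    where
    at : ∀ b → (if b then bitF p b else 1ₚ) ≡ 1ₚ
    at true  = refl
    at false = refl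

  -- x_B(V_A) = 0 if B ⊈ A: a coordinate j ∈ B ∖ A contributes the factor 0.
  monomial-vanishes : ∀ {n} (A B : Subset n) → B ⊈ A → monomial p B (V A) ≡ 0ₚ
  monomial-vanishes {n} A B B⊈A with ⊈⇒witness B⊈A
  ... | j , j∈B , j∉A = prod-zero (map (factor B A) (allFin n))
    (subst (List._∈ map (factor B A) (allFin n)) factor≡0 (∈-map⁺ (factor B A) (∈-allFin j)))
    where
    factor≡0 : factor B A j ≡ 0ₚ
    factor≡0 rewrite []=⇒lookup j∈B | ∉⇒lookup-outside j∉A = refl

  triangular⇒independent : Prime p → ∀ {n} (S : Subset n → Set) (g : Subset n → Ω n → 𝔽 p) →
    (∀ A → S A → g A (V A) ≢ 0ₚ) →
    (∀ A B → B ⊈ A → g B (V A) ≡ 0ₚ) →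
    LinearlyIndependent p n S g
  triangular⇒independent p-prime {n} S g diagonal upper c outside-S combination≡0 =
    λ A _ → vanish A
    where
    vanish : ∀ A → c A ≡ 0ₚ
    vanish = All.wfRec (On.wellFounded ∣_∣ <-wellFounded) _ (λ A → c A ≡ 0ₚ) step
      where
      -- Evaluating the combination at V_A, only the term of A survives.
      step : ∀ A → (∀ {B} → ∣ B ∣ < ∣ A ∣ → c B ≡ 0ₚ) → c A ≡ 0ₚ
      step A smaller with zero-product p-prime (c A) (g A (V A)) (begin
          c A *ₚ g A (V A)                                ≡⟨ sym (sum-single n A term off-diagonal) ⟩
          sumF p (map term (allSubsets n))                ≡⟨ combination≡0 (V A) ⟩
          0ₚ                                              ∎)
        where
        open ≡-Reasoning
        term : Subset n → 𝔽 p
        term B = c B *ₚ g B (V A)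
        off-diagonal : ∀ B → B ≢ A → term B ≡ 0ₚ
        off-diagonal B B≢A with B ⊆? A
        ... | yes B⊆A =
          trans (cong (_*ₚ g B (V A)) (smaller (⊆∧≢⇒∣∣< B⊆A B≢A))) (*-zeroˡ (g B (V A)))
        ... | no  B⊈A = trans (cong (c B *ₚ_) (upper A B B⊈A)) (*-zeroʳ (c B))
      ... | inj₁ cA≡0  = cA≡0
      ... | inj₂ gA≡0  = outside-S A (λ A∈S → diagonal A A∈S gA≡0)

lemma2 : (p : ℕ) .{{_ : NonZero p}} → Prime p → (n : ℕ) → n ≥ 1 →
    (f : Ω n → 𝔽 p) → (i : 𝔽 p) →
    (∀ (A : Subset n) → (∣ A ∣ mod p) ≢ i → f (V A) ≢ 0F p) →
    LinearlyIndependent p n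
    (λ A → ((∣ A ∣ mod p) ≢ i) × (∣ A ∣ < p))
    (λ A → monomial p A · f)
lemma2 p p-prime n _ f i f≢0 =
  triangular⇒independent p p-prime _ (λ A → monomial p A · f) diagonal upper
  where
  1<p : 1 < p
  1<p = ℕ.nonTrivial⇒n>1 p {{prime⇒nonTrivial p-prime}}

  diagonal : ∀ A → ((∣ A ∣ mod p) ≢ i) × (∣ A ∣ < p) → (monomial p A · f) (V A) ≢ 0F p
  diagonal A (∣A∣≢i , _) rewrite monomial-diagonal p 1<p A | *-identityˡ p 1<p (f (V A)) =
    f≢0 A ∣A∣≢i

  upper : ∀ A B → B ⊈ A → (monomial p B · f) (V A) ≡ 0F p
  upper A B B⊈A rewrite monomial-vanishes p A B B⊈A = *-zeroˡ p (f (V A))
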